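{- Let $(r_1,t_1)$ and $(r_2,t_2)$ be parameter pairs with $t_1 \leq t_2$. Let $$r = \max\{\, r_2,\ (r_1 \operatorname{div} (t_1+1))\cdot(t_2+1) + (r_1 \bmod (t_1+1)) \,\},$$ where $\operatorname{div}$ and $\bmod$ denote integer quotient and remainder. Then $(r_1,t_1) \leq (r,t_2)$ and $(r_2,t_2) \leq (r,t_2)$.
   Context: A parameter pair is a pair $(r,t)$ of nonnegative integers with $r \geq t$. For parameter pairs, $(r_1,t_1) \leq (r_2,t_2)$ means: there exists a strictly increasing (hence injective) map $\varphi: \{0,\ldots,r_1-1\} \to \{0,\ldots,r_2-1\}$ such that for all $a, b \in \{0,\ldots,r_1-1\}$, $|a-b| \leq t_1$ holds if and only if $|\varphi(a)-\varphi(b)| \leq t_2$. -}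

module Defs where

open import Data.Nat using (ℕ; _≤_; _<_; ∣_-_∣)
open import Data.Fin using (Fin; toℕ)
open import Data.Product using (Σ; _×_)
open import Function.Bundles using (_⇔_)

record ParamPair : Set where
  constructor pp
  field
    r   : ℕ
    t   : ℕ
    t≤r : t ≤ r
open ParamPair public

_≼_ : ParamPair → ParamPair → Set
P ≼ Q =
  Σ (Fin (r P) → Fin (r Q)) λ φ →
    ((a b : Fin (r P)) → toℕ a < toℕ b → toℕ (φ a) < toℕ (φ b))
    × ((a b : Fin (r P)) →
         (∣ toℕ a - toℕ b ∣ ≤ t P) ⇔ (∣ toℕ (φ a) - toℕ (φ b) ∣ ≤ t Q))

open import Data.Nat using (_⊔_; _+_; _*_; suc)
open import Data.Nat.DivMod using (_/_; _%_)
open import Data.Nat.Properties using (≤-trans; m≤m⊔n)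

bigR : ParamPair → ParamPair → ℕ
bigR P₁ P₂ = r P₂ ⊔ ((r P₁ / suc (t P₁)) * suc (t P₂) + r P₁ % suc (t P₁))

target : ParamPair → ParamPair → ParamPair
target P₁ P₂ = pp (bigR P₁ P₂) (t P₂) (≤-trans (t≤r P₂) (m≤m⊔n (r P₂) _))

module Submission where

-- An embedding (r₁,t₁) ≼ (r₂,t₂) can be given by any map
-- f : ℕ → ℕ that is strictly increasing, sends the window relation
-- |a-b| ≤ t₁ exactly onto |f a - f b| ≤ t₂, and satisfies f r₁ ≤ r₂
-- (lemma ≼-from-map).  Because both window relations are symmetric, it
-- suffices to check the window condition on ordered pairs a ≤ b, where
-- it reads  b ≤ a + t₁ ⇔ f b ≤ f a + t₂  (lemma window-⇔).
--
-- For (r₂,t₂) ≼ (r,t₂) the identity map works, since r₂ ≤ r.  For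
-- (r₁,t₁) ≼ (r,t₂) we cut ℕ into blocks of length t₁+1 and stretch every
-- block boundary apart by d = t₂ - t₁:  g n = n + d·⌊n/(t₁+1)⌋  (module
-- Stretch).  Points at distance ≤ t₁ lie in the same or adjacent blocks
-- and so end up at distance ≤ t₁ + d = t₂; points at distance ≥ t₁+1
-- are separated by at least one full stretched block and end up at
-- distance > t₂.  Finally g r₁ = ⌊r₁/(t₁+1)⌋·(t₂+1) + r₁ mod (t₁+1) ≤ r.

open import Defs
open import Data.Nat using (ℕ; suc; _≤_; _<_; _+_; _*_; _∸_; ∣_-_∣; _≤?_)
open import Data.Nat.Properties
open import Data.Nat.DivMod using (_/_; _%_; m/n≡1+[m∸n]/n; /-monoˡ-≤; m≡m%n+[m/n]*n)
open import Data.Nat.Solver using (module +-*-Solver)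
open import Data.Fin using (Fin; toℕ; fromℕ<)
open import Data.Fin.Properties using (toℕ-fromℕ<; toℕ<n)
open import Data.Product using (_×_; _,_)
open import Data.Sum using (inj₁; inj₂)
open import Function.Bundles using (_⇔_; mk⇔; module Equivalence)
open import Relation.Binary.PropositionalEquality
open import Relation.Nullary using (yes; no; contradiction)

open +-*-Solver using (solve; _:+_; _:*_; _:=_; con)

StrictlyIncreasing : (ℕ → ℕ) → Set
StrictlyIncreasing f = ∀ {a b} → a < b → f a < f b

distance≤⇔ : ∀ {a b} t → a ≤ b → (∣ a - b ∣ ≤ t) ⇔ (b ≤ a + t)
distance≤⇔ {a} {b} t a≤b rewrite m≤n⇒∣m-n∣≡n∸m a≤b = mk⇔ to from
  where
  to : b ∸ a ≤ t → b ≤ a + t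
  to h = subst (_≤ a + t) (m+[n∸m]≡n a≤b) (+-monoʳ-≤ a h)
  from : b ≤ a + t → b ∸ a ≤ t
  from h = subst (b ∸ a ≤_) (m+n∸m≡n a t) (∸-monoˡ-≤ a h)

increasing⇒monotone : ∀ {f} → StrictlyIncreasing f → ∀ {a b} → a ≤ b → f a ≤ f b
increasing⇒monotone inc a≤b with m≤n⇒m<n∨m≡n a≤b
... | inj₁ a<b = <⇒≤ (inc a<b)
... | inj₂ refl = ≤-refl

ordered-window-⇔ : ∀ {f s t} → StrictlyIncreasing f →
  (∀ {a b} → a ≤ b → (b ≤ a + s) ⇔ (f b ≤ f a + t)) →
  ∀ {a b} → a ≤ b → (∣ a - b ∣ ≤ s) ⇔ (∣ f a - f b ∣ ≤ t)
ordered-window-⇔ {f} {s} {t} inc ordered {a} {b} a≤b = mk⇔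
  (λ h → Equivalence.from image-window (Equivalence.to (ordered a≤b) (Equivalence.to (distance≤⇔ s a≤b) h)))
  (λ h → Equivalence.from (distance≤⇔ s a≤b) (Equivalence.from (ordered a≤b) (Equivalence.to image-window h)))
  where
  image-window : (∣ f a - f b ∣ ≤ t) ⇔ (f b ≤ f a + t)
  image-window = distance≤⇔ t (increasing⇒monotone inc a≤b)

window-⇔ : ∀ {f s t} → StrictlyIncreasing f →
  (∀ {a b} → a ≤ b → (b ≤ a + s) ⇔ (f b ≤ f a + t)) →
  ∀ a b → (∣ a - b ∣ ≤ s) ⇔ (∣ f a - f b ∣ ≤ t)
window-⇔ {f} inc ordered a b with ≤-total a b
... | inj₁ a≤b = ordered-window-⇔ inc ordered a≤b
... | inj₂ b≤a rewrite ∣-∣-comm a b | ∣-∣-comm (f a) (f b) = ordered-window-⇔ inc ordered b≤a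

≼-from-map : ∀ P Q (f : ℕ → ℕ) → StrictlyIncreasing f →
  (∀ a b → (∣ a - b ∣ ≤ t P) ⇔ (∣ f a - f b ∣ ≤ t Q)) →
  f (r P) ≤ r Q → P ≼ Q
≼-from-map P Q f inc window fr≤r = φ , increasing , respects
  where
  φ : Fin (r P) → Fin (r Q)
  φ a = fromℕ< (<-≤-trans (inc (toℕ<n a)) fr≤r)
  toℕ-φ : ∀ a → toℕ (φ a) ≡ f (toℕ a)
  toℕ-φ a = toℕ-fromℕ< _
  increasing : ∀ a b → toℕ a < toℕ b → toℕ (φ a) < toℕ (φ b)
  increasing a b a<b rewrite toℕ-φ a | toℕ-φ b = inc a<b
  respects : ∀ a b → (∣ toℕ a - toℕ b ∣ ≤ t P) ⇔ (∣ toℕ (φ a) - toℕ (φ b) ∣ ≤ t Q)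
  respects a b rewrite toℕ-φ a | toℕ-φ b = window (toℕ a) (toℕ b)

module Stretch {t t' : ℕ} (t≤t' : t ≤ t') where

  T d : ℕ
  T = suc t
  d = t' ∸ t

  stretch : ℕ → ℕ
  stretch n = n + d * (n / T)

  t+d≡t' : t + d ≡ t'
  t+d≡t' = m+[n∸m]≡n t≤t'

  next-block : ∀ a → (a + T) / T ≡ suc (a / T)
  next-block a = begin
    (a + T) / T          ≡⟨ m/n≡1+[m∸n]/n (m≤n+m T a) ⟩
    suc ((a + T ∸ T) / T) ≡⟨ cong (λ x → suc (x / T)) (m+n∸n≡m a T) ⟩
    suc (a / T)          ∎
    where open ≡-Reasoning

  shifted-bound : ∀ a q → a + t + d * suc q ≡ a + d * q + t'
  shifted-bound a q = trans
    (solve 4 (λ a q t d → a :+ t :+ d :* (con 1 :+ q) := a :+ d :* q :+ (t :+ d)) refl a q t d)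
    (cong (a + d * q +_) t+d≡t')

  stretch-increasing : StrictlyIncreasing stretch
  stretch-increasing a<b = +-mono-<-≤ a<b (*-monoʳ-≤ d (/-monoˡ-≤ T (<⇒≤ a<b)))

  -- Points within distance t lie in the same or in adjacent blocks.
  near : ∀ {a b} → b ≤ a + t → stretch b ≤ stretch a + t'
  near {a} {b} b≤a+t = begin
    b + d * (b / T)           ≤⟨ +-mono-≤ b≤a+t (*-monoʳ-≤ d b-block) ⟩
    a + t + d * suc (a / T)   ≡⟨ shifted-bound a (a / T) ⟩
    stretch a + t'            ∎
    where
    open ≤-Reasoning
    b-block : b / T ≤ suc (a / T)
    b-block = ≤-trans (/-monoˡ-≤ T (≤-trans b≤a+t (+-monoʳ-≤ a (n≤1+n t))))
                      (≤-reflexive (next-block a))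

  -- Points at distance at least t+1 lie in strictly later blocks.
  far : ∀ {a b} → a + T ≤ b → stretch a + t' < stretch b
  far {a} {b} a+T≤b = begin-strict
    stretch a + t'            ≡⟨ shifted-bound a (a / T) ⟨
    a + t + d * suc (a / T)   <⟨ +-monoˡ-< (d * suc (a / T)) (≤-reflexive (sym (+-suc a t))) ⟩
    a + T + d * suc (a / T)   ≤⟨ +-mono-≤ a+T≤b (*-monoʳ-≤ d b-block) ⟩
    stretch b                 ∎
    where
    open ≤-Reasoning
    b-block : suc (a / T) ≤ b / T
    b-block = ≤-trans (≤-reflexive (sym (next-block a))) (/-monoˡ-≤ T a+T≤b)

  stretch-window : ∀ {a b} → (b ≤ a + t) ⇔ (stretch b ≤ stretch a + t')
  stretch-window {a} {b} = mk⇔ near within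
    where
    within : stretch b ≤ stretch a + t' → b ≤ a + t
    within h with b ≤? a + t
    ... | yes b≤a+t = b≤a+t
    ... | no b≰a+t = contradiction h (<⇒≱ (far (subst (_≤ b) (sym (+-suc a t)) (≰⇒> b≰a+t))))

  stretch-length : ∀ r → stretch r ≡ (r / T) * suc t' + r % T
  stretch-length r = begin
    r + d * (r / T)                        ≡⟨ cong (_+ d * (r / T)) (m≡m%n+[m/n]*n r T) ⟩
    r % T + r / T * T + d * (r / T)        ≡⟨ solve 4 (λ m q t d → m :+ q :* (con 1 :+ t) :+ d :* q
                                                          := q :* (con 1 :+ (t :+ d)) :+ m) refl (r % T) (r / T) t d ⟩
    r / T * suc (t + d) + r % T            ≡⟨ cong (λ x → r / T * suc x + r % T) t+d≡t' ⟩
    r / T * suc t' + r % T                 ∎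
    where open ≡-Reasoning

lemma3 : (P₁ P₂ : ParamPair) → t P₁ ≤ t P₂ →
    (P₁ ≼ target P₁ P₂) × (P₂ ≼ target P₁ P₂)
lemma3 P₁ P₂ t₁≤t₂ =
  ≼-from-map P₁ (target P₁ P₂) stretch stretch-increasing
    (window-⇔ stretch-increasing (λ _ → stretch-window))
    (≤-trans (≤-reflexive (stretch-length (r P₁))) (m≤n⊔m (r P₂) _))
  , ≼-from-map P₂ (target P₁ P₂) (λ n → n) (λ a<b → a<b)
      (λ a b → mk⇔ (λ h → h) (λ h → h))
      (m≤m⊔n (r P₂) _)
  where open Stretch t₁≤t₂
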